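{- For every integer $n\ge 2$, $ir_b(P_n)=\gamma_b(P_n)=\left\lceil\frac{n}{3}\right\rceil$, where $P_n$ is the path of order $n$.
   Context: For a graph $G=(V,E)$, a broadcast is a function $f:V\to\{0,\dots,\operatorname{diam}(G)\}$ with $f(v)\le e_G(v)$ (eccentricity) for all $v$. Let $V^+_f=\{v: f(v)>0\}$ and $H_f(u)=\{v\in V^+_f: d_G(u,v)\le f(v)\}$. For $v\in V^+_f$, $PN_f(v)=\{u\in V: H_f(u)=\{v\}\}$, and $PB_f(v)$ is $\{v\}$ if $f(v)=1$ and $PN_f(v)=\{v\}$, and otherwise $PB_f(v)=\{u\in PN_f(v): d_G(u,v)=f(v)\}$. The cost is $\sigma(f)=\sum_v f(v)$. $f$ is dominating if $|H_f(u)|\ge1$ for all $u$; $\gamma_b(G)$ is the minimum cost of a dominating broadcast. $f$ is irredundant if $PB_f(v)\ne\emptyset$ for every $v\in V^+_f$; it is maximal irredundant if no irredundant broadcast $g\ne f$ satisfies $g\ge f$ pointwise; $ir_b(G)$ is the minimum cost of a maximal irredundant broadcast. -}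

module Defs where

open import Data.Nat using (ℕ; zero; suc; _+_; _≤_; _<_; _⊔_; ∣_-_∣)
open import Data.Fin using (Fin; toℕ)
import Data.Fin as F
open import Data.Product using (Σ; ∃; _×_; _,_)
open import Data.Sum using (_⊎_)
open import Relation.Binary.PropositionalEquality using (_≡_)
open import Relation.Nullary using (¬_)

maxF : ∀ {n} → (Fin n → ℕ) → ℕ
maxF {zero}  h = 0
maxF {suc n} h = h F.zero ⊔ maxF (λ i → h (F.suc i))

sumF : ∀ {n} → (Fin n → ℕ) → ℕ
sumF {zero}  h = 0
sumF {suc n} h = h F.zero + sumF (λ i → h (F.suc i))

-- A connected graph on vertex set Fin n is represented here through its
-- distance function d_G : Fin n → Fin n → ℕ; all broadcast notions below
-- depend on G only through d_G.
Dist : ℕ → Set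
Dist n = Fin n → Fin n → ℕ

pathDist : (n : ℕ) → Dist n
pathDist n i j = ∣ toℕ i - toℕ j ∣

module Broadcasts {n : ℕ} (d : Dist n) where

  ecc : Fin n → ℕ
  ecc v = maxF (λ u → d v u)

  diam : ℕ
  diam = maxF ecc

  IsBroadcast : (Fin n → ℕ) → Set
  IsBroadcast f = ∀ v → (f v ≤ diam) × (f v ≤ ecc v)

  σ : (Fin n → ℕ) → ℕ
  σ f = sumF f

  InVplus : (Fin n → ℕ) → Fin n → Set
  InVplus f v = 0 < f v

  InH : (Fin n → ℕ) → Fin n → Fin n → Set
  InH f u v = InVplus f v × (d u v ≤ f v)

  InPN : (Fin n → ℕ) → Fin n → Fin n → Set
  InPN f v u = ∀ w → (InH f u w → w ≡ v) × (w ≡ v → InH f u w)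

  Special : (Fin n → ℕ) → Fin n → Set
  Special f v = (f v ≡ 1) × (∀ x → (InPN f v x → x ≡ v) × (x ≡ v → InPN f v x))

  InPB : (Fin n → ℕ) → Fin n → Fin n → Set
  InPB f v u =
      (Special f v × (u ≡ v))
    ⊎ (¬ Special f v × InPN f v u × (d u v ≡ f v))

  IsDominating : (Fin n → ℕ) → Set
  IsDominating f = IsBroadcast f × (∀ u → ∃ λ v → InH f u v)

  IsIrredundant : (Fin n → ℕ) → Set
  IsIrredundant f = IsBroadcast f × (∀ v → InVplus f v → ∃ λ u → InPB f v u)

  IsMaximalIrredundant : (Fin n → ℕ) → Set
  IsMaximalIrredundant f =
    IsIrredundant f ×
    (∀ g → IsIrredundant g → (∀ v → f v ≤ g v) → ∀ v → g v ≡ f v)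

  IsMinCost : ((Fin n → ℕ) → Set) → ℕ → Set
  IsMinCost P k = (∃ λ f → P f × (σ f ≡ k)) × (∀ f → P f → k ≤ σ f)

  BroadcastDomNumber : ℕ → Set
  BroadcastDomNumber = IsMinCost IsDominating

  LowerBroadcastIrrNumber : ℕ → Set
  LowerBroadcastIrrNumber = IsMinCost IsMaximalIrredundant

-- Upper bound: give power 1 to every third vertex, starting so that both ends are dominated.
-- These ⌈n/3⌉ vertices dominate the path and are pairwise at distance at least 3, so each has a
-- private neighbour on its boundary; a dominating irredundant broadcast of powers ≤ 1 cannot be
-- enlarged, so it is maximal.
--
-- Lower bound: give every broadcasting vertex v a window of 3 f(v) consecutive vertices and show
-- that the windows cover the path, so n ≤ 3 σ(f). For a dominating broadcast the window
-- starting at v - f(v) contains the ball of v. For a maximal irredundant broadcast f, maximality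
-- forbids raising any f(v) so far that an uncovered vertex becomes a private boundary vertex of v
-- while all other private boundaries survive. Hence every uncovered vertex is an outer neighbour
-- of a ball, and no ball has uncovered outer neighbours on both sides; the window of such a ball
-- is shifted to contain its uncovered neighbour. For balls of radius 1 the shifted window loses
-- the opposite neighbour of v, which two further raising arguments place in another window.

module Submission where

open import Defs
open import Data.Empty using (⊥; ⊥-elim)
open import Data.Fin using (Fin; toℕ; fromℕ<) renaming (zero to fz; suc to fs)
open import Data.Fin.Properties using (toℕ-injective; toℕ-fromℕ<; toℕ<n; any?) renaming (_≟_ to _≟ᶠ_)
open import Data.Nat using (ℕ; zero; suc; _+_; _*_; _∸_; _≤_; _<_; ∣_-_∣; z≤n; s≤s; _/_)
open import Data.Nat.DivMod using (m<n*o⇒m/o<n; m/n≡1+[m∸n]/n)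
open import Data.Nat.Properties
open import Algebra.Properties.Semiring.Sum +-*-semiring using (sum; ∑-comm; *-distribˡ-sum)
open import Data.Nat.Tactic.RingSolver using (solve-∀)
open import Data.Product using (Σ; ∃; _×_; _,_; proj₁; proj₂)
open import Data.Sum using (_⊎_; inj₁; inj₂)
open import Data.Vec.Functional using (updateAt)
open import Data.Vec.Functional.Properties using (updateAt-updates; updateAt-minimal)
open import Function using (const)
open import Function.Metric.Nat.Structures using (IsMetric)
open import Relation.Binary.PropositionalEquality
open import Relation.Nullary using (¬_; Dec; yes; no; contradiction)
open import Relation.Nullary.Decidable using (_×-dec_; ¬?)

-- Distances on ℕ

∣m-n∣≤o⇒m≤n+o×n≤m+o : ∀ m n o → ∣ m - n ∣ ≤ o → m ≤ n + o × n ≤ m + o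
∣m-n∣≤o⇒m≤n+o×n≤m+o zero    n       o p = z≤n , p
∣m-n∣≤o⇒m≤n+o×n≤m+o (suc m) zero    o p = p , z≤n
∣m-n∣≤o⇒m≤n+o×n≤m+o (suc m) (suc n) o p with ∣m-n∣≤o⇒m≤n+o×n≤m+o m n o p
... | a , b = s≤s a , s≤s b

m≤n+o×n≤m+o⇒∣m-n∣≤o : ∀ m n o → m ≤ n + o → n ≤ m + o → ∣ m - n ∣ ≤ o
m≤n+o×n≤m+o⇒∣m-n∣≤o zero    n       o a       b       = b
m≤n+o×n≤m+o⇒∣m-n∣≤o (suc m) zero    o a       b       = a
m≤n+o×n≤m+o⇒∣m-n∣≤o (suc m) (suc n) o (s≤s a) (s≤s b) = m≤n+o×n≤m+o⇒∣m-n∣≤o m n o a b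

∣m-n∣≡o⇒m≡n+o⊎n≡m+o : ∀ m n o → ∣ m - n ∣ ≡ o → m ≡ n + o ⊎ n ≡ m + o
∣m-n∣≡o⇒m≡n+o⊎n≡m+o zero    n       o e = inj₂ e
∣m-n∣≡o⇒m≡n+o⊎n≡m+o (suc m) zero    o e = inj₁ e
∣m-n∣≡o⇒m≡n+o⊎n≡m+o (suc m) (suc n) o e with ∣m-n∣≡o⇒m≡n+o⊎n≡m+o m n o e
... | inj₁ x = inj₁ (cong suc x)
... | inj₂ y = inj₂ (cong suc y)

∣m-n∣≡1⇒m≡1+n⊎n≡1+m : ∀ m n → ∣ m - n ∣ ≡ 1 → m ≡ suc n ⊎ n ≡ suc m
∣m-n∣≡1⇒m≡1+n⊎n≡1+m m n e with ∣m-n∣≡o⇒m≡n+o⊎n≡m+o m n 1 e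
... | inj₁ m≡n+1 = inj₁ (trans m≡n+1 (+-comm n 1))
... | inj₂ n≡m+1 = inj₂ (trans n≡m+1 (+-comm m 1))

∣n-n∣≤m : ∀ n m → ∣ n - n ∣ ≤ m
∣n-n∣≤m n m = subst (_≤ m) (sym (∣n-n∣≡0 n)) z≤n

∣n+o-n∣≡o : ∀ n o → ∣ n + o - n ∣ ≡ o
∣n+o-n∣≡o n o = trans (∣-∣-comm (n + o) n) (∣m-m+n∣≡n n o)

m≡o+n⇒∣m-n∣≡o : ∀ {m n} o → m ≡ o + n → ∣ m - n ∣ ≡ o
m≡o+n⇒∣m-n∣≡o {n = n} o refl = trans (cong (∣_- n ∣) (+-comm o n)) (∣n+o-n∣≡o n o)

n≡o+m⇒∣m-n∣≡o : ∀ {m n} o → n ≡ o + m → ∣ m - n ∣ ≡ o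
n≡o+m⇒∣m-n∣≡o {m} o refl = trans (∣-∣-comm m (o + m)) (m≡o+n⇒∣m-n∣≡o o refl)

∣n-1+n∣≡1 : ∀ n → ∣ n - suc n ∣ ≡ 1
∣n-1+n∣≡1 zero    = refl
∣n-1+n∣≡1 (suc n) = ∣n-1+n∣≡1 n

∣1+n-n∣≡1 : ∀ n → ∣ suc n - n ∣ ≡ 1
∣1+n-n∣≡1 n = trans (∣-∣-comm (suc n) n) (∣n-1+n∣≡1 n)

∣m-n∣≤1⇒n≡m⊎1+n≡m⊎n≡1+m : ∀ m n → ∣ m - n ∣ ≤ 1 → n ≡ m ⊎ suc n ≡ m ⊎ n ≡ suc m
∣m-n∣≤1⇒n≡m⊎1+n≡m⊎n≡1+m zero          zero          _ = inj₁ refl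
∣m-n∣≤1⇒n≡m⊎1+n≡m⊎n≡1+m zero          (suc zero)    _ = inj₂ (inj₂ refl)
∣m-n∣≤1⇒n≡m⊎1+n≡m⊎n≡1+m (suc zero)    zero          _ = inj₂ (inj₁ refl)
∣m-n∣≤1⇒n≡m⊎1+n≡m⊎n≡1+m zero          (suc (suc n)) (s≤s ())
∣m-n∣≤1⇒n≡m⊎1+n≡m⊎n≡1+m (suc (suc m)) zero          (s≤s ())
∣m-n∣≤1⇒n≡m⊎1+n≡m⊎n≡1+m (suc m)       (suc n)       p with ∣m-n∣≤1⇒n≡m⊎1+n≡m⊎n≡1+m m n p
... | inj₁ e          = inj₁ (cong suc e)
... | inj₂ (inj₁ e)   = inj₂ (inj₁ (cong suc e))
... | inj₂ (inj₂ e)   = inj₂ (inj₂ (cong suc e))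

∣-∣≡-pigeonhole : ∀ a b c p o → ∣ a - p ∣ ≡ o → ∣ b - p ∣ ≡ o → ∣ c - p ∣ ≡ o →
                  a ≡ b ⊎ a ≡ c ⊎ b ≡ c
∣-∣≡-pigeonhole a b c p o ea eb ec
  with ∣m-n∣≡o⇒m≡n+o⊎n≡m+o a p o ea
     | ∣m-n∣≡o⇒m≡n+o⊎n≡m+o b p o eb
     | ∣m-n∣≡o⇒m≡n+o⊎n≡m+o c p o ec
... | inj₁ x | inj₁ y | _      = inj₁ (trans x (sym y))
... | inj₂ x | inj₂ y | _      = inj₁ (+-cancelʳ-≡ o a b (trans (sym x) y))
... | inj₁ x | inj₂ _ | inj₁ z = inj₂ (inj₁ (trans x (sym z)))
... | inj₁ _ | inj₂ y | inj₂ z = inj₂ (inj₂ (+-cancelʳ-≡ o b c (trans (sym y) z)))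
... | inj₂ _ | inj₁ y | inj₁ z = inj₂ (inj₂ (trans y (sym z)))
... | inj₂ x | inj₁ _ | inj₂ z = inj₂ (inj₁ (+-cancelʳ-≡ o a c (trans (sym x) z)))

n≡m+k⇒m≤n : ∀ {m n} k → n ≡ m + k → m ≤ n
n≡m+k⇒m≤n {m} k refl = m≤m+n m k

0<m∧m≱2⇒m≡1 : ∀ {m} → 0 < m → ¬ 2 ≤ m → m ≡ 1
0<m∧m≱2⇒m≡1 0<m m≱2 = ≤-antisym (≤-pred (≰⇒> m≱2)) 0<m

n≤3*s⇒[n+2]/3≤s : ∀ n s → n ≤ 3 * s → (n + 2) / 3 ≤ s
n≤3*s⇒[n+2]/3≤s n s n≤3s = <⇒≤pred (m<n*o⇒m/o<n {n + 2} {suc s} {3} lt)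
  where
  lt : n + 2 < suc s * 3
  lt = begin-strict
    n + 2         ≤⟨ +-monoˡ-≤ 2 n≤3s ⟩
    3 * s + 2     <⟨ +-monoʳ-< (3 * s) (n<1+n 2) ⟩
    3 * s + 3     ≡⟨ +-comm (3 * s) 3 ⟩
    3 + 3 * s     ≡⟨ *-suc 3 s ⟨
    3 * suc s     ≡⟨ *-comm 3 (suc s) ⟩
    suc s * 3     ∎
    where open ≤-Reasoning

-- Counting points covered by windows

sumF≡sum : ∀ {n} (h : Fin n → ℕ) → sumF h ≡ sum h
sumF≡sum {zero}  h = refl
sumF≡sum {suc n} h = cong (h fz +_) (sumF≡sum (λ i → h (fs i)))

sum-mono-≤ : ∀ {n} {g h : Fin n → ℕ} → (∀ i → g i ≤ h i) → sum g ≤ sum h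
sum-mono-≤ {zero}  g≤h = z≤n
sum-mono-≤ {suc n} g≤h = +-mono-≤ (g≤h fz) (sum-mono-≤ (λ i → g≤h (fs i)))

sum-ones : ∀ n → sum {n} (λ _ → 1) ≡ n
sum-ones zero    = refl
sum-ones (suc n) = cong suc (sum-ones n)

≤-sum : ∀ {n} (h : Fin n → ℕ) i → h i ≤ sum h
≤-sum h fz     = m≤m+n (h fz) _
≤-sum h (fs i) = ≤-trans (≤-sum (λ j → h (fs j)) i) (m≤n+m _ (h fz))

-- indicator of the window [s, s + m)
window : ℕ → ℕ → ℕ → ℕ
window (suc s) m       zero    = 0
window (suc s) m       (suc x) = window s m x
window zero    zero    x       = 0
window zero    (suc m) zero    = 1
window zero    (suc m) (suc x) = window zero m x

window≡1 : ∀ s m x → s ≤ x → x < s + m → window s m x ≡ 1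
window≡1 (suc s) m       (suc x) (s≤s p) (s≤s q) = window≡1 s m x p q
window≡1 zero    (suc m) zero    p       q       = refl
window≡1 zero    (suc m) (suc x) p       (s≤s q) = window≡1 zero m x z≤n q

sum-window≤ : ∀ n s m → sum {n} (λ x → window s m (toℕ x)) ≤ m
sum-window≤ zero    s       m       = z≤n
sum-window≤ (suc n) (suc s) m       = sum-window≤ n s m
sum-window≤ (suc n) zero    zero    = sum-window≤ n zero zero
sum-window≤ (suc n) zero    (suc m) = s≤s (sum-window≤ n zero m)

InWindow : ℕ → ℕ → ℕ → Set
InWindow s m x = s ≤ x × x < s + m

-- Double counting of (point, window) incidences.
cover⇒≤sum : ∀ {k n} (lo len : Fin k → ℕ) →
             (∀ (x : Fin n) → ∃ λ v → InWindow (lo v) (len v) (toℕ x)) → n ≤ sum len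
cover⇒≤sum {k} {n} lo len cover = begin
  n                                      ≡⟨ sum-ones n ⟨
  sum {n} (λ _ → 1)                      ≤⟨ sum-mono-≤ (λ x → hit x (cover x)) ⟩
  sum (λ x → sum (λ v → incidence x v))  ≡⟨ ∑-comm incidence ⟩
  sum (λ v → sum (λ x → incidence x v))  ≤⟨ sum-mono-≤ (λ v → sum-window≤ n (lo v) (len v)) ⟩
  sum len                                ∎
  where
  open ≤-Reasoning
  incidence : Fin n → Fin k → ℕ
  incidence x v = window (lo v) (len v) (toℕ x)
  hit : ∀ x → (∃ λ v → InWindow (lo v) (len v) (toℕ x)) → 1 ≤ sum (incidence x)
  hit x (v , s≤x , x<e) = ≤-trans (≤-reflexive (sym (window≡1 _ _ _ s≤x x<e))) (≤-sum (incidence x) v)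

cover⇒≤3σ : ∀ {n} (f lo : Fin n → ℕ) →
            (∀ (x : Fin n) → ∃ λ v → InWindow (lo v) (3 * f v) (toℕ x)) → n ≤ 3 * sumF f
cover⇒≤3σ {n} f lo cover = begin
  n                     ≤⟨ cover⇒≤sum lo (λ v → 3 * f v) cover ⟩
  sum (λ v → 3 * f v)   ≡⟨ *-distribˡ-sum 3 f ⟨
  3 * sum f             ≡⟨ cong (3 *_) (sumF≡sum f) ⟨
  3 * sumF f            ∎
  where open ≤-Reasoning

-- Windows of length 3r attached to a ball of radius r centred at P and extended to an
-- uncovered outer neighbour q, on the left (q + 1 + r = P) or on the right (P + 1 + r = q).

ball⊆window : ∀ {P r p} → 0 < r → ∣ p - P ∣ ≤ r → InWindow (P ∸ r) (3 * r) p
ball⊆window {P} {suc r} {p} _ p∈ball with ∣m-n∣≤o⇒m≤n+o×n≤m+o p P (suc r) p∈ball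
... | p≤P+r , P≤p+r = m≤n+o⇒m∸n≤o P (suc r) (subst (P ≤_) (+-comm p (suc r)) P≤p+r) , (begin-strict
  p                            ≤⟨ p≤P+r ⟩
  P + suc r                    ≤⟨ +-monoˡ-≤ (suc r) (m≤n+m∸n P (suc r)) ⟩
  suc r + (P ∸ suc r) + suc r  <⟨ m<m+n _ (s≤s z≤n) ⟩
  _                            ≡⟨ rearrange (P ∸ suc r) r ⟨
  P ∸ suc r + 3 * suc r        ∎)
  where
  open ≤-Reasoning
  rearrange : ∀ a r → a + 3 * suc r ≡ suc r + a + suc r + suc r
  rearrange = solve-∀

left-gap<ball : ∀ {q r P p} → q + suc r ≡ P → ∣ p - P ∣ ≤ r → q < p
left-gap<ball {q} {r} {P} {p} refl p∈ball = +-cancelʳ-≤ r (suc q) p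
  (subst (_≤ p + r) (+-suc q r) (proj₂ (∣m-n∣≤o⇒m≤n+o×n≤m+o p P r p∈ball)))

ball<right-gap : ∀ {P r q p} → P + suc r ≡ q → ∣ p - P ∣ ≤ r → p < q
ball<right-gap {P} {r} {p = p} refl p∈ball =
  ≤-<-trans (proj₁ (∣m-n∣≤o⇒m≤n+o×n≤m+o p P r p∈ball)) (+-monoʳ-< P (n<1+n r))

left-window-near : ∀ {q r P p} → 0 < r → q + suc r ≡ P → ∣ p - P ∣ ≤ r → p ≤ P → InWindow q (3 * r) p
left-window-near {q} {suc r} _ refl p∈ball p≤P =
  <⇒≤ (left-gap<ball refl p∈ball) , ≤-<-trans p≤P (n≡m+k⇒m≤n (2 * r) (eq q r))
  where
  eq : ∀ q r → q + 3 * suc r ≡ suc (q + suc (suc r)) + 2 * r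
  eq = solve-∀

left-window-gap : ∀ {q r} → 0 < r → InWindow q (3 * r) q
left-window-gap {q} {r} 0<r = ≤-refl , m<m+n q (*-monoʳ-< 3 0<r)

left-window-ball : ∀ {q r P p} → 2 ≤ r → q + suc r ≡ P → ∣ p - P ∣ ≤ r → InWindow q (3 * r) p
left-window-ball {r = suc zero} (s≤s ())
left-window-ball {q} {suc (suc r)} {P} {p} _ refl p∈ball =
  <⇒≤ (left-gap<ball refl p∈ball) ,
  ≤-<-trans (proj₁ (∣m-n∣≤o⇒m≤n+o×n≤m+o p P (suc (suc r)) p∈ball)) (n≡m+k⇒m≤n r (eq q r))
  where
  eq : ∀ q r → q + 3 * suc (suc r) ≡ suc (q + suc (suc (suc r)) + suc (suc r)) + r
  eq = solve-∀

right-window : ∀ {q r p} → p ≤ q → suc q ≤ p + 3 * r → InWindow (suc q ∸ 3 * r) (3 * r) p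
right-window {q} {r} {p} p≤q q<p+3r =
  m≤n+o⇒m∸n≤o (suc q) (3 * r) (subst (suc q ≤_) (+-comm p (3 * r)) q<p+3r) ,
  ≤-trans (s≤s p≤q) (subst (suc q ≤_) (+-comm (3 * r) _) (m≤n+m∸n (suc q) (3 * r)))

right-window-near : ∀ {P r q p} → 0 < r → P + suc r ≡ q → ∣ p - P ∣ ≤ r → P ≤ p →
                    InWindow (suc q ∸ 3 * r) (3 * r) p
right-window-near {P} {suc r} {p = p} _ refl p∈ball P≤p =
  right-window {r = suc r} (<⇒≤ (ball<right-gap refl p∈ball))
    (≤-trans (n≡m+k⇒m≤n (2 * r) (eq P r)) (+-monoˡ-≤ (3 * suc r) P≤p))
  where
  eq : ∀ P r → P + 3 * suc r ≡ suc (P + suc (suc r)) + 2 * r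
  eq = solve-∀

right-window-gap : ∀ {q r} → 0 < r → InWindow (suc q ∸ 3 * r) (3 * r) q
right-window-gap {q} {suc r} _ = right-window {r = suc r} ≤-refl (n≡m+k⇒m≤n (2 + 3 * r) (eq q r))
  where
  eq : ∀ q r → q + 3 * suc r ≡ suc q + (2 + 3 * r)
  eq = solve-∀

right-window-ball : ∀ {P r q p} → 2 ≤ r → P + suc r ≡ q → ∣ p - P ∣ ≤ r → InWindow (suc q ∸ 3 * r) (3 * r) p
right-window-ball {r = suc zero} (s≤s ())
right-window-ball {P} {suc (suc r)} {p = p} _ refl p∈ball =
  right-window {r = suc (suc r)} (<⇒≤ (ball<right-gap refl p∈ball)) (begin
  suc (P + suc (suc (suc r)))        ≤⟨ n≡m+k⇒m≤n r (eq₁ P r) ⟩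
  P + 2 * suc (suc r)                ≤⟨ +-monoˡ-≤ (2 * suc (suc r)) P≤p+r ⟩
  p + suc (suc r) + 2 * suc (suc r)  ≡⟨ eq₂ p r ⟩
  p + 3 * suc (suc r)                ∎)
  where
  open ≤-Reasoning
  P≤p+r = proj₂ (∣m-n∣≤o⇒m≤n+o×n≤m+o p P (suc (suc r)) p∈ball)
  eq₁ : ∀ P r → P + 2 * suc (suc r) ≡ suc (P + suc (suc (suc r))) + r
  eq₁ = solve-∀
  eq₂ : ∀ p r → p + suc (suc r) + 2 * suc (suc r) ≡ p + 3 * suc (suc r)
  eq₂ = solve-∀

ball-left-edge : ∀ p W r → ∣ suc p - W ∣ ≤ r → ¬ ∣ p - W ∣ ≤ r → p + suc r ≡ W
ball-left-edge p W r in-ball out with ∣m-n∣≤o⇒m≤n+o×n≤m+o (suc p) W r in-ball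
... | 1+p≤W+r , W≤1+p+r with W ≤? p + r
...   | yes W≤p+r = contradiction (m≤n+o×n≤m+o⇒∣m-n∣≤o p W r (≤-trans (n≤1+n p) 1+p≤W+r) W≤p+r) out
...   | no  W≰p+r = ≤-antisym (subst (_≤ W) (sym (+-suc p r)) (≰⇒> W≰p+r)) (subst (W ≤_) (sym (+-suc p r)) W≤1+p+r)

ball-right-edge : ∀ p W r → ∣ p - W ∣ ≤ r → ¬ ∣ suc p - W ∣ ≤ r → W + suc r ≡ suc p
ball-right-edge p W r in-ball out with ∣m-n∣≤o⇒m≤n+o×n≤m+o p W r in-ball
... | p≤W+r , W≤p+r with suc p ≤? W + r
...   | yes 1+p≤W+r = contradiction (m≤n+o×n≤m+o⇒∣m-n∣≤o (suc p) W r 1+p≤W+r (≤-trans W≤p+r (n≤1+n _))) out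
...   | no  1+p≰W+r = trans (+-suc W r) (cong suc (≤-antisym (≤-pred (≰⇒> 1+p≰W+r)) p≤W+r))

inside-left-edge : ∀ {X C U r} → 2 ≤ r → C + suc r ≡ U → X ≡ 3 + C → ∣ X - U ∣ ≤ r
inside-left-edge {r = suc zero} (s≤s ())
inside-left-edge {X} {C} {U} {suc (suc r)} _ refl refl =
  subst (_≤ suc (suc r)) (sym (n≡o+m⇒∣m-n∣≡o r (eq C r))) (m≤n+m r 2)
  where
  eq : ∀ C r → C + suc (suc (suc r)) ≡ r + (3 + C)
  eq = solve-∀

inside-right-edge : ∀ {X D U r} → 2 ≤ r → U + suc r ≡ D → D ≡ 3 + X → ∣ X - U ∣ ≤ r
inside-right-edge {r = suc zero} (s≤s ())
inside-right-edge {X} {D} {U} {suc (suc r)} _ U+r+1≡D refl =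
  subst (_≤ suc (suc r)) (sym (m≡o+n⇒∣m-n∣≡o r (+-cancelˡ-≡ 3 _ _ (trans (sym U+r+1≡D) (eq U r))))) (m≤n+m r 2)
  where
  eq : ∀ U r → U + suc (suc (suc r)) ≡ 3 + (r + U)
  eq = solve-∀

-- Broadcasts on a finite metric space

≤-maxF : ∀ {n} (h : Fin n → ℕ) i → h i ≤ maxF h
≤-maxF h fz     = m≤m⊔n (h fz) _
≤-maxF h (fs i) = ≤-trans (≤-maxF (λ j → h (fs j)) i) (m≤n⊔m (h fz) _)

module BroadcastTheory {n : ℕ} (d : Dist n) (isMetric : IsMetric _≡_ d) where

  open Broadcasts d public
  open IsMetric isMetric using (≈⇒0; triangle) renaming (sym to d-sym)

  d≤ecc : ∀ u v → d u v ≤ ecc v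
  d≤ecc u v = subst (_≤ ecc v) (d-sym v u) (≤-maxF (d v) u)

  ecc≤diam : ∀ v → ecc v ≤ diam
  ecc≤diam = ≤-maxF ecc

  InH-self : ∀ f v → InVplus f v → InH f v v
  InH-self _ _ p = p , subst (_≤ _) (sym (≈⇒0 refl)) z≤n

  InPN⇒InH : ∀ {f v u} → InPN f v u → InH f u v
  InPN⇒InH pn = proj₂ (pn _) refl

  InPN-unique : ∀ {f v u w} → InPN f v u → InH f u w → w ≡ v
  InPN-unique pn h = proj₁ (pn _) h

  InPB⇒InPN : ∀ {f v u} → InPB f v u → InPN f v u
  InPB⇒InPN (inj₁ ((_ , spec) , refl)) = proj₂ (spec _) refl
  InPB⇒InPN (inj₂ (_ , pn , _))        = pn

  InPN⇒InPB : ∀ {f v u} → InPN f v u → d u v ≡ f v → InVplus f v → InPB f v u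
  InPN⇒InPB {f} {v} {u} pn duv pos = inj₂ (¬special , pn , duv)
    where
    ¬special : ¬ Special f v
    ¬special (_ , spec) with proj₁ (spec u) pn
    ... | refl = <-irrefl refl (subst (0 <_) (trans (sym duv) (≈⇒0 refl)) pos)

  Covered : (Fin n → ℕ) → Fin n → Set
  Covered f u = ∃ (InH f u)

  Uncovered : (Fin n → ℕ) → Fin n → Set
  Uncovered f u = ¬ Covered f u

  InH? : ∀ f u v → Dec (InH f u v)
  InH? f u v = (0 <? f v) ×-dec (d u v ≤? f v)

  Covered? : ∀ f u → Dec (Covered f u)
  Covered? f u = any? (InH? f u)

  HearsOther : (Fin n → ℕ) → Fin n → Fin n → Set
  HearsOther f x v = ∃ λ w → w ≢ v × InH f x w

  HearsOther? : ∀ f x v → Dec (HearsOther f x v)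
  HearsOther? f x v = any? (λ w → ¬? (w ≟ᶠ v) ×-dec InH? f x w)

  ¬HearsOther⇒InPN : ∀ {f x v} → InH f x v → ¬ HearsOther f x v → InPN f v x
  ¬HearsOther⇒InPN {f} {x} {v} h ¬other w = to , λ { refl → h }
    where
    to : InH f x w → w ≡ v
    to hw with w ≟ᶠ v
    ... | yes w≡v = w≡v
    ... | no  w≢v = contradiction (w , w≢v , hw) ¬other

  module Raise (f : Fin n → ℕ) (z : Fin n) {k : ℕ} (fz<k : f z < k) where

    g : Fin n → ℕ
    g = updateAt f z (const k)

    g-z : g z ≡ k
    g-z = updateAt-updates z f

    g-other : ∀ {w} → w ≢ z → g w ≡ f w
    g-other {w} w≢z = updateAt-minimal w z f w≢z

    f≤g : ∀ w → f w ≤ g w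
    f≤g w with w ≟ᶠ z
    ... | yes refl = subst (f w ≤_) (sym g-z) (<⇒≤ fz<k)
    ... | no  w≢z  = ≤-reflexive (sym (g-other w≢z))

    InH-f⇒g : ∀ {u w} → InH f u w → InH g u w
    InH-f⇒g {w = w} (p , q) = ≤-trans p (f≤g w) , ≤-trans q (f≤g w)

    InH-g⇒f : ∀ {u w} → w ≢ z → InH g u w → InH f u w
    InH-g⇒f w≢z h rewrite g-other w≢z = h

    ¬InH-far : ∀ {x} → k < d x z → ¬ InH g x z
    ¬InH-far far (_ , h) = <⇒≱ far (subst (d _ z ≤_) g-z h)

    InPN-f⇒g : ∀ {y x} → y ≢ z → k < d x z → InPN f y x → InPN g y x
    InPN-f⇒g {y} {x} y≢z far pn w = to , λ { refl → InH-f⇒g (InPN⇒InH pn) }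
      where
      to : InH g x w → w ≡ y
      to h with w ≟ᶠ z
      ... | yes refl = contradiction h (¬InH-far far)
      ... | no  w≢z  = InPN-unique pn (InH-g⇒f w≢z h)

    InPN-g⇒f : ∀ {y x} → y ≢ z → InPN g y x → InPN f y x
    InPN-g⇒f y≢z pn w = (λ h → InPN-unique pn (InH-f⇒g h)) , λ { refl → InH-g⇒f y≢z (InPN⇒InH pn) }

  -- Raising f z to k = d u₀ z makes the uncovered u₀ a private boundary vertex of z, and
  -- keeps every other boundary vertex lying outside the new ball of z.
  maximal⇒¬raisable : ∀ {f} → IsMaximalIrredundant f → ∀ z {k} u₀ → f z < k → d u₀ z ≡ k →
                      Uncovered f u₀ →
                      (∀ y → InVplus f y → y ≢ z → ∃ λ u → InPB f y u × k < d u z) → ⊥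
  maximal⇒¬raisable {f} ((bf , _) , maximal) z {k} u₀ fz<k du₀z≡k u₀-unc keep =
    <-irrefl (trans (sym (maximal g (bg , irr-g) f≤g z)) g-z) fz<k
    where
    open Raise f z fz<k

    bg : IsBroadcast g
    bg w with w ≟ᶠ z
    ... | yes refl = subst (λ t → t ≤ diam × t ≤ ecc w) (sym g-z) (≤-trans k≤ecc (ecc≤diam z) , k≤ecc)
      where k≤ecc = subst (_≤ ecc z) du₀z≡k (d≤ecc u₀ z)
    ... | no  w≢z  = subst (λ t → t ≤ diam × t ≤ ecc w) (sym (g-other w≢z)) (bf w)

    u₀-private : InPN g z u₀
    u₀-private w = to , λ { refl → subst (0 <_) (sym g-z) (≤-<-trans z≤n fz<k) ,
                                   ≤-reflexive (trans du₀z≡k (sym g-z)) }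
      where
      to : InH g u₀ w → w ≡ z
      to h with w ≟ᶠ z
      ... | yes w≡z = w≡z
      ... | no  w≢z = contradiction (w , InH-g⇒f w≢z h) u₀-unc

    irr-g : ∀ y → InVplus g y → ∃ (InPB g y)
    irr-g y pos with y ≟ᶠ z
    ... | yes refl = u₀ , InPN⇒InPB u₀-private (trans du₀z≡k (sym g-z)) pos
    ... | no  y≢z  with keep y (subst (0 <_) (g-other y≢z) pos) y≢z
    ...   | u , inj₂ (_ , pn , du) , far = u , InPN⇒InPB (InPN-f⇒g y≢z far pn) (trans du (sym (g-other y≢z))) pos
    ...   | u , inj₁ ((fy≡1 , spec) , refl) , far = y , inj₁ ((trans (g-other y≢z) fy≡1 , spec′) , refl)
      where
      spec′ : ∀ x → (InPN g y x → x ≡ y) × (x ≡ y → InPN g y x)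
      spec′ x = (λ pn → proj₁ (spec x) (InPN-g⇒f y≢z pn)) , λ { refl → InPN-f⇒g y≢z far (proj₂ (spec y) refl) }

  dominating-≤1-irredundant⇒maximal : ∀ {f} → IsDominating f → (∀ v → f v ≤ 1) → IsIrredundant f →
                                       IsMaximalIrredundant f
  dominating-≤1-irredundant⇒maximal {f} (_ , dom) f≤1 irr = irr , maximal
    where
    maximal : ∀ g → IsIrredundant g → (∀ v → f v ≤ g v) → ∀ v → g v ≡ f v
    maximal g (_ , irr-g) f≤g v with g v ≤? f v
    ... | yes g≤f = ≤-antisym g≤f (f≤g v)
    ... | no  g≰f with irr-g v (≤-<-trans z≤n (≰⇒> g≰f))
    ...   | u , pb with dom u
    ...     | s , (ps , dus) with InPN-unique (InPB⇒InPN pb) (≤-trans ps (f≤g s) , ≤-trans dus (f≤g s))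
    ...       | refl = ⊥-elim (¬InPB pb)
      where
      -- u is g-private to v yet f-dominated, so only by v, whose f-radius is 1 < g v.
      2≤gv : 2 ≤ g v
      2≤gv = subst (λ t → suc t ≤ g v) (≤-antisym (f≤1 v) ps) (≰⇒> g≰f)
      ¬InPB : ¬ InPB g v u
      ¬InPB (inj₁ ((gv≡1 , _) , _)) = <-irrefl (sym gv≡1) 2≤gv
      ¬InPB (inj₂ (_ , _ , duv≡gv)) = <⇒≱ 2≤gv (subst (_≤ 1) duv≡gv (≤-trans dus (f≤1 v)))

  packing⇒irredundant : ∀ {f} → IsBroadcast f → (∀ v → f v ≤ 1) →
                        (∀ v w → InVplus f v → InVplus f w → d v w ≤ 2 → v ≡ w) →
                        (∀ v → ∃ λ u → d u v ≡ 1) → IsIrredundant f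
  packing⇒irredundant {f} bf f≤1 packed neighbour = bf , boundary
    where
    fv≡1 : ∀ {v} → InVplus f v → f v ≡ 1
    fv≡1 {v} pos = ≤-antisym (f≤1 v) pos

    neighbour-private : ∀ {v u} → InVplus f v → d u v ≡ 1 → InPN f v u
    neighbour-private {v} {u} pos duv w = to , λ { refl → pos , ≤-reflexive (trans duv (sym (fv≡1 pos))) }
      where
      open ≤-Reasoning
      to : InH f u w → w ≡ v
      to (pw , duw) = sym (packed v w pos pw (begin
        d v w          ≤⟨ triangle v u w ⟩
        d v u + d u w  ≤⟨ +-mono-≤ (≤-reflexive (trans (d-sym v u) duv)) (≤-trans duw (f≤1 w)) ⟩
        2              ∎))

    boundary : ∀ v → InVplus f v → ∃ (InPB f v)
    boundary v pos with neighbour v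
    ... | u , duv = u , InPN⇒InPB (neighbour-private pos duv) (trans duv (sym (fv≡1 pos))) pos

-- The path and its every-third broadcast

pathDist-isMetric : ∀ n → IsMetric _≡_ (pathDist n)
pathDist-isMetric n = record
  { isSemiMetric = record
    { isQuasiSemiMetric = record
      { isPreMetric = record
        { isProtoMetric = record
          { isPartialOrder  = ≤-isPartialOrder
          ; ≈-isEquivalence = isEquivalence
          ; cong            = cong₂ (pathDist n)
          ; nonNegative     = z≤n
          }
        ; ≈⇒0 = λ { {x} refl → ∣n-n∣≡0 (toℕ x) }
        }
      ; 0⇒≈ = λ d≡0 → toℕ-injective (∣m-n∣≡0⇒m≡n d≡0)
      }
    ; sym = λ u v → ∣-∣-comm (toℕ u) (toℕ v)
    }
  ; triangle = λ u v w → ∣-∣-triangle (toℕ u) (toℕ v) (toℕ w)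
  }

vertex : ∀ {n} p → p < n → Σ (Fin n) (λ u → toℕ u ≡ p)
vertex p p<n = fromℕ< p<n , toℕ-fromℕ< p<n

path-neighbour : ∀ {n} → 2 ≤ n → ∀ (v : Fin n) → ∃ λ u → pathDist n u v ≡ 1
path-neighbour {n} 2≤n v with toℕ v | toℕ<n v
... | zero  | _   = let (u , u≡1) = vertex 1 2≤n in u , cong (λ t → ∣ t - 0 ∣) u≡1
... | suc p | p<n = let (u , u≡p) = vertex p (<-trans (n<1+n p) p<n) in
  u , trans (cong (λ t → ∣ t - suc p ∣) u≡p) (∣n-1+n∣≡1 p)

oneMod3 : ℕ → ℕ
oneMod3 0                   = 0
oneMod3 1                   = 1
oneMod3 2                   = 0
oneMod3 (suc (suc (suc i))) = oneMod3 i

oneMod3≤1 : ∀ i → oneMod3 i ≤ 1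
oneMod3≤1 0                   = z≤n
oneMod3≤1 1                   = s≤s z≤n
oneMod3≤1 2                   = z≤n
oneMod3≤1 (suc (suc (suc i))) = oneMod3≤1 i

oneMod3-sparse : ∀ {a b} → oneMod3 a ≡ 1 → oneMod3 b ≡ 1 → a ≤ b → b ≤ 2 + a → a ≡ b
oneMod3-sparse {1} {1} _ _ _ _ = refl
oneMod3-sparse {1} {suc (suc (suc (suc b)))} _ _ _ (s≤s (s≤s (s≤s ())))
oneMod3-sparse {suc (suc (suc a))} {suc (suc (suc b))} ea eb (s≤s (s≤s (s≤s a≤b))) b≤2+a =
  cong (3 +_) (oneMod3-sparse ea eb a≤b (≤-pred (≤-pred (≤-pred b≤2+a))))

oneMod3-near : ∀ a → oneMod3 a ≡ 1 ⊎ oneMod3 (suc a) ≡ 1 ⊎ ∃ λ a′ → a ≡ suc a′ × oneMod3 a′ ≡ 1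
oneMod3-near 0 = inj₂ (inj₁ refl)
oneMod3-near 1 = inj₁ refl
oneMod3-near 2 = inj₂ (inj₂ (1 , refl , refl))
oneMod3-near (suc (suc (suc a))) with oneMod3-near a
... | inj₁ e                   = inj₁ e
... | inj₂ (inj₁ e)            = inj₂ (inj₁ e)
... | inj₂ (inj₂ (a′ , refl , e)) = inj₂ (inj₂ (3 + a′ , refl , e))

oneMod3-three : ∀ a b → oneMod3 a + (oneMod3 (suc a) + (oneMod3 (suc (suc a)) + b)) ≡ suc b
oneMod3-three 0                   b = refl
oneMod3-three 1                   b = refl
oneMod3-three 2                   b = refl
oneMod3-three (suc (suc (suc a))) b = oneMod3-three a b

-- Marks sit at the residue 1 mod 3 when 3 ∣ n, and at the residue 0 otherwise.
offset : ℕ → ℕ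
offset 0                   = 0
offset 1                   = 1
offset 2                   = 1
offset (suc (suc (suc n))) = offset n

offset≤1 : ∀ n → offset n ≤ 1
offset≤1 0                   = z≤n
offset≤1 1                   = s≤s z≤n
offset≤1 2                   = s≤s z≤n
offset≤1 (suc (suc (suc n))) = offset≤1 n

oneMod3-past-end : ∀ n → oneMod3 (n + offset n) ≡ 0
oneMod3-past-end 0                   = refl
oneMod3-past-end 1                   = refl
oneMod3-past-end 2                   = refl
oneMod3-past-end (suc (suc (suc n))) = oneMod3-past-end n

marks : (n : ℕ) → Fin n → ℕ
marks n v = oneMod3 (toℕ v + offset n)

sumF-marks : ∀ n → sumF (marks n) ≡ (n + 2) / 3
sumF-marks 0                   = refl
sumF-marks 1                   = refl
sumF-marks 2                   = refl
sumF-marks (suc (suc (suc n))) = begin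
  sumF (marks (3 + n))    ≡⟨ oneMod3-three (offset n) (sumF (marks n)) ⟩
  suc (sumF (marks n))    ≡⟨ cong suc (sumF-marks n) ⟩
  suc ((n + 2) / 3)       ≡⟨ m/n≡1+[m∸n]/n {3 + n + 2} {3} (s≤s (s≤s (s≤s z≤n))) ⟨
  (3 + n + 2) / 3         ∎
  where open ≡-Reasoning

module Path (n : ℕ) where

  open BroadcastTheory (pathDist n) (pathDist-isMetric n) public

  d : Fin n → Fin n → ℕ
  d = pathDist n

  d-sym : ∀ u v → d u v ≡ d v u
  d-sym u v = ∣-∣-comm (toℕ u) (toℕ v)

  d≡0⇒≡ : ∀ u v → d u v ≡ 0 → u ≡ v
  d≡0⇒≡ _ _ d≡0 = toℕ-injective (∣m-n∣≡0⇒m≡n d≡0)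

  dominating⇒n≤3σ : ∀ {f} → IsDominating f → n ≤ 3 * σ f
  dominating⇒n≤3σ {f} (_ , dom) = cover⇒≤3σ f (λ v → toℕ v ∸ f v) covering
    where
    covering : ∀ x → ∃ λ v → InWindow (toℕ v ∸ f v) (3 * f v) (toℕ x)
    covering x with dom x
    ... | v , pos , x∈ball = v , ball⊆window pos x∈ball

  marks-≤1 : ∀ v → marks n v ≤ 1
  marks-≤1 v = oneMod3≤1 (toℕ v + offset n)

  marked : ∀ v → InVplus (marks n) v → marks n v ≡ 1
  marked v pos = ≤-antisym (marks-≤1 v) pos

  marks-broadcast : 2 ≤ n → IsBroadcast (marks n)
  marks-broadcast 2≤n v = ≤-trans 1≤ecc (ecc≤diam v) , 1≤ecc
    where
    1≤ecc : marks n v ≤ ecc v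
    1≤ecc with path-neighbour 2≤n v
    ... | u , duv≡1 = ≤-trans (marks-≤1 v) (subst (_≤ ecc v) duv≡1 (d≤ecc u v))

  marks-sparse : ∀ {v w} → InVplus (marks n) v → InVplus (marks n) w →
                 toℕ v ≤ toℕ w → toℕ w ≤ toℕ v + 2 → v ≡ w
  marks-sparse {v} {w} pv pw v≤w w≤v+2 =
    toℕ-injective (+-cancelʳ-≡ (offset n) (toℕ v) (toℕ w)
      (oneMod3-sparse (marked v pv) (marked w pw) (+-monoˡ-≤ (offset n) v≤w) (begin
        toℕ w + offset n        ≤⟨ +-monoˡ-≤ (offset n) w≤v+2 ⟩
        toℕ v + 2 + offset n    ≡⟨ cong (_+ offset n) (+-comm (toℕ v) 2) ⟩
        2 + toℕ v + offset n    ≡⟨ +-assoc 2 (toℕ v) (offset n) ⟩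
        2 + (toℕ v + offset n)  ∎)))
    where open ≤-Reasoning

  marks-packed : ∀ v w → InVplus (marks n) v → InVplus (marks n) w → pathDist n v w ≤ 2 → v ≡ w
  marks-packed v w pv pw dvw≤2 with ∣m-n∣≤o⇒m≤n+o×n≤m+o (toℕ v) (toℕ w) 2 dvw≤2 | ≤-total (toℕ v) (toℕ w)
  ... | _ , w≤v+2 | inj₁ v≤w = marks-sparse pv pw v≤w w≤v+2
  ... | v≤w+2 , _ | inj₂ w≤v = sym (marks-sparse pw pv w≤v v≤w+2)

  marks-dominating : 2 ≤ n → IsDominating (marks n)
  marks-dominating 2≤n = marks-broadcast 2≤n , dominated
    where
    heard : ∀ i v → oneMod3 (toℕ v + offset n) ≡ 1 → ∣ i - toℕ v ∣ ≤ 1 →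
            0 < marks n v × ∣ i - toℕ v ∣ ≤ marks n v
    heard i v e d≤1 = subst (0 <_) (sym e) (s≤s z≤n) , subst (∣ i - toℕ v ∣ ≤_) (sym e) d≤1

    dominated : ∀ x → ∃ (InH (marks n) x)
    dominated x with oneMod3-near (toℕ x + offset n)
    ... | inj₁ e = x , heard (toℕ x) x e (∣n-n∣≤m (toℕ x) 1)
    ... | inj₂ (inj₁ e) with suc (toℕ x) <? n
    ...   | yes 1+x<n = let (v , v≡1+x) = vertex (suc (toℕ x)) 1+x<n in
      v , heard (toℕ x) v (trans (cong (λ t → oneMod3 (t + offset n)) v≡1+x) e)
                (≤-reflexive (trans (cong (∣_-_∣ (toℕ x)) v≡1+x) (∣n-1+n∣≡1 (toℕ x))))
    ...   | no  1+x≮n = contradiction (trans (sym e) (trans (cong (λ t → oneMod3 (t + offset n)) last)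
                                                            (oneMod3-past-end n))) 1+n≢0
      where
      last : suc (toℕ x) ≡ n
      last = ≤-antisym (toℕ<n x) (≮⇒≥ 1+x≮n)
    dominated x | inj₂ (inj₂ (a′ , x+o≡1+a′ , e)) with toℕ x in x≡
    ... | zero = contradiction (subst (λ t → oneMod3 t ≡ 1) a′≡0 e) 0≢1+n
      where
      a′≡0 : a′ ≡ 0
      a′≡0 = n≤0⇒n≡0 (≤-pred (subst (_≤ 1) x+o≡1+a′ (offset≤1 n)))
    ... | suc p = let (v , v≡p) = vertex p (<-trans (n<1+n p) (subst (_< n) x≡ (toℕ<n x))) in
      v , heard (suc p) v (trans (cong (λ t → oneMod3 (t + offset n)) v≡p)
                       (subst (λ t → oneMod3 t ≡ 1) (sym (suc-injective x+o≡1+a′)) e))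
                (≤-reflexive (trans (cong (∣_-_∣ (suc p)) v≡p) (∣1+n-n∣≡1 p)))

  marks-maximal : 2 ≤ n → IsMaximalIrredundant (marks n)
  marks-maximal 2≤n = dominating-≤1-irredundant⇒maximal (marks-dominating 2≤n) marks-≤1
    (packing⇒irredundant (marks-broadcast 2≤n) marks-≤1 marks-packed (path-neighbour 2≤n))

-- Windows of a maximal irredundant broadcast on the path

module MaximalIrredundantCover {n : ℕ} (2≤n : 2 ≤ n) {f : Fin n → ℕ}
  (maximal : Broadcasts.IsMaximalIrredundant (pathDist n) f) where

  open Path n

  irredundant : ∀ v → InVplus f v → ∃ (InPB f v)
  irredundant = proj₂ (proj₁ maximal)

  PB-heard : ∀ {y u} → InPB f y u → InH f u y
  PB-heard {y} {u} pb = InPN⇒InH {f} {y} {u} (InPB⇒InPN {f} {y} {u} pb)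

  PB-private : ∀ {y u w} → InPB f y u → InH f u w → w ≡ y
  PB-private {y} {u} pb = InPN-unique {f} {y} {u} (InPB⇒InPN {f} {y} {u} pb)

  self-heard : ∀ v → InVplus f v → InH f v v
  self-heard = InH-self f

  unit⇒InVplus : ∀ {v} → f v ≡ 1 → InVplus f v
  unit⇒InVplus fv≡1 = subst (0 <_) (sym fv≡1) (s≤s z≤n)

  uncovered⇒covered-neighbour : ∀ x → Uncovered f x → ∃ λ u → d u x ≡ 1 × Covered f u
  uncovered⇒covered-neighbour x x-unc with any? (λ u → (d u x ≟ 1) ×-dec Covered? f u)
  ... | yes found = found
  ... | no  none  = ⊥-elim (maximal⇒¬raisable maximal x u₀ fx<1 du₀x (near-uncovered u₀ (≤-reflexive du₀x)) far)
    where
    u₀ = proj₁ (path-neighbour 2≤n x)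
    du₀x = proj₂ (path-neighbour 2≤n x)

    near-uncovered : ∀ u → d u x ≤ 1 → Uncovered f u
    near-uncovered u du≤1 cov with n≤1⇒n≡0∨n≡1 du≤1
    ... | inj₁ du≡0 = x-unc (subst (Covered f) (d≡0⇒≡ u x du≡0) cov)
    ... | inj₂ du≡1 = none (u , du≡1 , cov)

    fx<1 : f x < 1
    fx<1 = ≰⇒> (λ pos → x-unc (x , self-heard x pos))

    far : ∀ y → InVplus f y → y ≢ x → ∃ λ u → InPB f y u × 1 < d u x
    far y pos _ with irredundant y pos
    ... | u , pb = u , pb , ≰⇒> (λ du≤1 → near-uncovered u du≤1 (y , PB-heard pb))

  LeftGap : Fin n → Set
  LeftGap v = ∃ λ q → toℕ q + suc (f v) ≡ toℕ v × Uncovered f q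

  RightGap : Fin n → Set
  RightGap v = ∃ λ q → toℕ v + suc (f v) ≡ toℕ q × Uncovered f q

  LeftGap? : ∀ v → Dec (LeftGap v)
  LeftGap? v = any? (λ q → (toℕ q + suc (f v) ≟ toℕ v) ×-dec ¬? (Covered? f q))

  RightGap? : ∀ v → Dec (RightGap v)
  RightGap? v = any? (λ q → (toℕ v + suc (f v) ≟ toℕ q) ×-dec ¬? (Covered? f q))

  ¬LeftGap×RightGap : ∀ {v} → InVplus f v → LeftGap v → RightGap v → ⊥
  ¬LeftGap×RightGap {v} pos (q₁ , q₁v , q₁-unc) (q₂ , vq₂ , q₂-unc) =
    maximal⇒¬raisable maximal v q₁ ≤-refl (n≡o+m⇒∣m-n∣≡o (suc (f v)) (trans (sym q₁v) (+-comm (toℕ q₁) _)))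
      q₁-unc far
    where
    far : ∀ y → InVplus f y → y ≢ v → ∃ λ u → InPB f y u × suc (f v) < d u v
    far y py y≢v with irredundant y py
    ... | u , pb = u , pb , ≰⇒> excluded
      where
      excluded : d u v ≤ suc (f v) → ⊥
      excluded du≤ with m≤n⇒m<n∨m≡n du≤
      ... | inj₁ du≤fv = y≢v (sym (PB-private pb (pos , ≤-pred du≤fv)))
      ... | inj₂ du≡ with ∣m-n∣≡o⇒m≡n+o⊎n≡m+o (toℕ u) (toℕ v) _ du≡
      ...   | inj₁ u≡ = q₂-unc (y , subst (λ t → InH f t y) (toℕ-injective (trans u≡ vq₂)) (PB-heard pb))
      ...   | inj₂ v≡ = q₁-unc (y , subst (λ t → InH f t y)
                                    (toℕ-injective (+-cancelʳ-≡ (suc (f v)) _ _ (trans (sym v≡) (sym q₁v))))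
                                    (PB-heard pb))

  ¬private-opposite-gap : ∀ v w q x → f v ≡ 1 → d w v ≡ 1 → d q w ≡ 1 → d q v ≡ 2 → Uncovered f q →
                          d x v ≡ 1 → d x w ≡ 2 → ¬ InPN f v x
  ¬private-opposite-gap v w q x fv≡1 dwv dqw dqv q-unc dxv dxw x-private =
    maximal⇒¬raisable maximal w q fw<1 dqw q-unc far
    where
    pv = unit⇒InVplus fv≡1

    fw<1 : f w < 1
    fw<1 = ≰⇒> (λ pw → q-unc (w , pw , subst (_≤ f w) (sym dqw) pw))

    far : ∀ y → InVplus f y → y ≢ w → ∃ λ u → InPB f y u × 1 < d u w
    far y py _ with y ≟ᶠ v
    ... | yes refl = x , InPN⇒InPB x-private (trans dxv (sym fv≡1)) py , subst (1 <_) (sym dxw) ≤-refl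
    ... | no  y≢v  with irredundant y py
    ...   | u , pb = u , pb , ≰⇒> excluded
      where
      excluded : d u w ≤ 1 → ⊥
      excluded du≤1 with n≤1⇒n≡0∨n≡1 du≤1
      ... | inj₁ du≡0 = y≢v (sym (PB-private pb
                          (pv , ≤-reflexive (trans (cong (λ t → d t v) (d≡0⇒≡ u w du≡0)) (trans dwv (sym fv≡1))))))
      ... | inj₂ du≡1 with ∣-∣≡-pigeonhole (toℕ u) (toℕ q) (toℕ v) (toℕ w) 1 du≡1 dqw (trans (d-sym v w) dwv)
      ...   | inj₁ u≡q          = q-unc (y , subst (λ t → InH f t y) (toℕ-injective u≡q) (PB-heard pb))
      ...   | inj₂ (inj₁ u≡v)   = y≢v (sym (PB-private pb
                                  (subst (λ t → InH f t v) (sym (toℕ-injective u≡v)) (self-heard v pv))))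
      ...   | inj₂ (inj₂ q≡v)   = q-unc (v , subst (λ t → InH f t v) (sym (toℕ-injective q≡v)) (self-heard v pv))

  ¬private-beyond-unit : ∀ v q y c → f v ≡ 1 → d q v ≡ 2 → Uncovered f q → f y ≡ 1 → d y v ≡ 2 →
                         InPN f y c → d c y ≡ 1 → d c v ≡ 3 → ⊥
  ¬private-beyond-unit v q y c fv≡1 dqv q-unc fy≡1 dyv c-private dcy dcv =
    maximal⇒¬raisable maximal v q (subst (_< 2) (sym fv≡1) ≤-refl) dqv q-unc far
    where
    py = unit⇒InVplus fy≡1

    far : ∀ y′ → InVplus f y′ → y′ ≢ v → ∃ λ u → InPB f y′ u × 2 < d u v
    far y′ py′ y′≢v with y′ ≟ᶠ y
    ... | yes refl = c , InPN⇒InPB c-private (trans dcy (sym fy≡1)) py′ , subst (2 <_) (sym dcv) ≤-refl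
    ... | no  y′≢y with irredundant y′ py′
    ...   | u , pb = u , pb , ≰⇒> excluded
      where
      excluded : d u v ≤ 2 → ⊥
      excluded du≤2 with m≤n⇒m<n∨m≡n du≤2
      ... | inj₁ du<2 = y′≢v (sym (PB-private pb (unit⇒InVplus fv≡1 , subst (d u v ≤_) (sym fv≡1) (≤-pred du<2))))
      ... | inj₂ du≡2 with ∣-∣≡-pigeonhole (toℕ u) (toℕ q) (toℕ y) (toℕ v) 2 du≡2 dqv dyv
      ...   | inj₁ u≡q        = q-unc (y′ , subst (λ t → InH f t y′) (toℕ-injective u≡q) (PB-heard pb))
      ...   | inj₂ (inj₁ u≡y) = y′≢y (sym (PB-private pb
                                (subst (λ t → InH f t y) (sym (toℕ-injective u≡y)) (self-heard y py))))
      ...   | inj₂ (inj₂ q≡y) = q-unc (y , subst (λ t → InH f t y) (sym (toℕ-injective q≡y)) (self-heard y py))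

  -- A ball with an uncovered outer neighbour has its window shifted to include it; by
  -- ¬LeftGap×RightGap this happens on at most one side.
  start : Fin n → ℕ
  start v with LeftGap? v | RightGap? v
  ... | yes (q , _) | _           = toℕ q
  ... | no _        | yes (q , _) = suc (toℕ q) ∸ 3 * f v
  ... | no _        | no _        = toℕ v ∸ f v

  InW : Fin n → ℕ → Set
  InW v = InWindow (start v) (3 * f v)

  left-near∈InW : ∀ {v p} → 0 < f v → LeftGap v → ∣ p - toℕ v ∣ ≤ f v → p ≤ toℕ v → InW v p
  left-near∈InW {v} pos (q , qv , q-unc) p∈ball p≤v with LeftGap? v | RightGap? v
  ... | yes (_ , q′v , _) | _ = left-window-near pos q′v p∈ball p≤v
  ... | no  ¬l            | _ = contradiction (q , qv , q-unc) ¬l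

  left-gap∈InW : ∀ {v q} → 0 < f v → toℕ q + suc (f v) ≡ toℕ v → Uncovered f q → InW v (toℕ q)
  left-gap∈InW {v} {q} pos qv q-unc with LeftGap? v | RightGap? v
  ... | yes (q′ , q′v , _) | _ = subst (InWindow (toℕ q′) (3 * f v)) (+-cancelʳ-≡ (suc (f v)) _ _ (trans q′v (sym qv)))
                                       (left-window-gap pos)
  ... | no  ¬l             | _ = contradiction (q , qv , q-unc) ¬l

  right-near∈InW : ∀ {v p} → 0 < f v → RightGap v → ∣ p - toℕ v ∣ ≤ f v → toℕ v ≤ p → InW v p
  right-near∈InW {v} pos r p∈ball v≤p with LeftGap? v | RightGap? v
  ... | yes l | _                 = ⊥-elim (¬LeftGap×RightGap pos l r)
  ... | no  _ | yes (_ , vq′ , _) = right-window-near pos vq′ p∈ball v≤p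
  ... | no  _ | no  ¬r            = contradiction r ¬r

  right-gap∈InW : ∀ {v q} → 0 < f v → toℕ v + suc (f v) ≡ toℕ q → Uncovered f q → InW v (toℕ q)
  right-gap∈InW {v} {q} pos vq q-unc with LeftGap? v | RightGap? v
  ... | yes l | _                  = ⊥-elim (¬LeftGap×RightGap pos l (q , vq , q-unc))
  ... | no  _ | yes (q′ , vq′ , _) = subst (λ t → InWindow (suc t ∸ 3 * f v) (3 * f v) (toℕ q)) (trans (sym vq) vq′)
                                           (right-window-gap pos)
  ... | no  _ | no  ¬r             = contradiction (q , vq , q-unc) ¬r

  centred∈InW : ∀ {v p} → ¬ LeftGap v → ¬ RightGap v → 0 < f v → ∣ p - toℕ v ∣ ≤ f v → InW v p
  centred∈InW {v} ¬l ¬r pos p∈ball with LeftGap? v | RightGap? v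
  ... | yes l | _     = contradiction l ¬l
  ... | no  _ | yes r = contradiction r ¬r
  ... | no  _ | no  _ = ball⊆window pos p∈ball

  ball⊆InW : ∀ {v p} → 2 ≤ f v → ∣ p - toℕ v ∣ ≤ f v → InW v p
  ball⊆InW {v} 2≤fv p∈ball with LeftGap? v | RightGap? v
  ... | yes (_ , qv , _) | _                = left-window-ball 2≤fv qv p∈ball
  ... | no _             | yes (_ , vq , _) = right-window-ball 2≤fv vq p∈ball
  ... | no _             | no _             = ball⊆window (≤-trans (s≤s z≤n) 2≤fv) p∈ball

  centre∈InW : ∀ {v} → 0 < f v → InW v (toℕ v)
  centre∈InW {v} pos with ∣n-n∣≤m (toℕ v) (f v) | LeftGap? v | RightGap? v
  ... | v∈ball | yes (_ , qv , _) | _                = left-window-near pos qv v∈ball ≤-refl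
  ... | v∈ball | no _             | yes (_ , vq , _) = right-window-near pos vq v∈ball ≤-refl
  ... | v∈ball | no _             | no _             = ball⊆window pos v∈ball

  left-edge : ∀ {w p q} → InH f p w → Uncovered f q → toℕ p ≡ suc (toℕ q) → toℕ q + suc (f w) ≡ toℕ w
  left-edge {w} {p} {q} (pw , p∈w) q-unc p≡1+q =
    ball-left-edge (toℕ q) (toℕ w) (f w) (subst (λ t → ∣ t - toℕ w ∣ ≤ f w) p≡1+q p∈w)
                   (λ q∈w → q-unc (w , pw , q∈w))

  right-edge : ∀ {w p q} → InH f p w → Uncovered f q → toℕ q ≡ suc (toℕ p) → toℕ w + suc (f w) ≡ toℕ q
  right-edge {w} {p} {q} (pw , p∈w) q-unc q≡1+p =
    trans (ball-right-edge (toℕ p) (toℕ w) (f w) p∈w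
                           (λ q∈w → q-unc (w , pw , subst (λ t → ∣ t - toℕ w ∣ ≤ f w) (sym q≡1+p) q∈w)))
          (sym q≡1+p)

  uncovered∈InW : ∀ x → Uncovered f x → ∃ λ w → InW w (toℕ x)
  uncovered∈InW x x-unc with uncovered⇒covered-neighbour x x-unc
  ... | u , dux , w , u-heard with ∣m-n∣≡1⇒m≡1+n⊎n≡1+m (toℕ u) (toℕ x) dux
  ...   | inj₁ u≡1+x = w , left-gap∈InW (proj₁ u-heard) (left-edge u-heard x-unc u≡1+x) x-unc
  ...   | inj₂ x≡1+u = w , right-gap∈InW (proj₁ u-heard) (right-edge u-heard x-unc x≡1+u) x-unc

  unit-left-gap : ∀ {v q : Fin n} → f v ≡ 1 → toℕ q + suc (f v) ≡ toℕ v → toℕ v ≡ 2 + toℕ q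
  unit-left-gap {v} {q} fv≡1 qv = trans (sym qv) (trans (cong (λ t → toℕ q + suc t) fv≡1) (+-comm (toℕ q) 2))

  unit-right-gap : ∀ {v q : Fin n} → f v ≡ 1 → toℕ v + suc (f v) ≡ toℕ q → toℕ q ≡ 2 + toℕ v
  unit-right-gap {v} {q} fv≡1 vq = trans (sym vq) (trans (cong (λ t → toℕ v + suc t) fv≡1) (+-comm (toℕ v) 2))

  vertex-below : ∀ {p} (a : Fin n) → toℕ a ≡ suc p → Σ (Fin n) (λ b → toℕ b ≡ p)
  vertex-below {p} a a≡1+p = vertex p (<-trans (n<1+n p) (subst (_< n) a≡1+p (toℕ<n a)))

  dist : ∀ k {a b} → toℕ a ≡ k + toℕ b → d a b ≡ k
  dist k = m≡o+n⇒∣m-n∣≡o k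

  dist′ : ∀ k {a b} → toℕ b ≡ k + toℕ a → d a b ≡ k
  dist′ k = n≡o+m⇒∣m-n∣≡o k

  -- The window [v - 2, v] of a radius-1 ball with an uncovered left gap q misses v + 1.
  module RightOfLeftGappedUnit {v q : Fin n} (fv≡1 : f v ≡ 1) (v≡2+q : toℕ v ≡ 2 + toℕ q)
                               (q-unc : Uncovered f q) where

    pv : InVplus f v
    pv = unit⇒InVplus fv≡1

    beyond-far-gap : ∀ {x u c₄ : Fin n} → f u ≡ 1 → u ≢ v → toℕ u ≡ 2 + toℕ v →
                     toℕ u ≡ suc (toℕ x) → toℕ c₄ ≡ 2 + toℕ u → Uncovered f c₄ → ∃ λ w → InW w (toℕ x)
    beyond-far-gap {x} {u} {c₄} fu≡1 u≢v u≡2+v u≡1+x c₄≡2+u c₄-unc with vertex-below c₄ c₄≡2+u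
    ... | c₃ , c₃≡1+u with HearsOther? f c₃ u
    ...   | no alone = ⊥-elim (¬private-beyond-unit v q u c₃ fv≡1 (dist′ 2 v≡2+q) q-unc fu≡1 (dist 2 u≡2+v)
                                 (¬HearsOther⇒InPN {f} {c₃} {u} c₃-heard alone) (dist 1 c₃≡1+u)
                                 (dist 3 (trans c₃≡1+u (cong suc u≡2+v))))
      where
      c₃-heard : InH f c₃ u
      c₃-heard = unit⇒InVplus fu≡1 , ≤-reflexive (trans (dist 1 c₃≡1+u) (sym fu≡1))
    ...   | yes (u′ , u′≢u , c₃-heard′) with 2 ≤? f u′
    ...     | yes 2≤fu′ = u′ , ball⊆InW 2≤fu′ (inside-right-edge 2≤fu′ edge
                                  (trans c₄≡2+u (cong (2 +_) u≡1+x)))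
      where
      edge = right-edge c₃-heard′ c₄-unc (trans c₄≡2+u (cong suc (sym c₃≡1+u)))
    ...     | no  ¬2≤fu′ =
      contradiction (toℕ-injective (+-cancelʳ-≡ 2 _ _ (trans unit-edge (trans c₄≡2+u (+-comm 2 _))))) u′≢u
      where
      edge = right-edge c₃-heard′ c₄-unc (trans c₄≡2+u (cong suc (sym c₃≡1+u)))
      unit-edge = trans (cong (λ t → toℕ u′ + suc t) (sym (0<m∧m≱2⇒m≡1 (proj₁ c₃-heard′) ¬2≤fu′))) edge

    via-unit : ∀ {x u : Fin n} → toℕ x ≡ suc (toℕ v) → f u ≡ 1 → u ≢ v → toℕ u ≡ suc (toℕ x) →
               InH f x u → ∃ λ w → InW w (toℕ x)
    via-unit {x} {u} x≡1+v fu≡1 u≢v u≡1+x x-heard with LeftGap? u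
    ... | yes (q′ , q′u , q′-unc) = ⊥-elim (q′-unc (v , subst (λ t → InH f t v) (sym q′≡v) (self-heard v pv)))
      where
      q′≡v : q′ ≡ v
      q′≡v = toℕ-injective (suc-injective (suc-injective
               (trans (sym (unit-left-gap fu≡1 q′u)) (trans u≡1+x (cong suc x≡1+v)))))
    ... | no ¬l with RightGap? u
    ...   | no  ¬r = u , centred∈InW ¬l ¬r (proj₁ x-heard) (proj₂ x-heard)
    ...   | yes (c₄ , uc₄ , c₄-unc) =
      beyond-far-gap fu≡1 u≢v (trans u≡1+x (cong suc x≡1+v)) u≡1+x (unit-right-gap fu≡1 uc₄) c₄-unc

    right-neighbour∈InW : ∀ {x : Fin n} → toℕ x ≡ suc (toℕ v) → InH f x v → ∃ λ w → InW w (toℕ x)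
    right-neighbour∈InW {x} x≡1+v x-heard with HearsOther? f x v
    ... | no alone with vertex-below v v≡2+q
    ...   | w , w≡1+q = ⊥-elim (¬private-opposite-gap v w q x fv≡1
                                  (dist′ 1 v≡1+w) (dist′ 1 w≡1+q) (dist′ 2 v≡2+q) q-unc
                                  (dist 1 x≡1+v) (dist 2 (trans x≡1+v (cong suc v≡1+w)))
                                  (¬HearsOther⇒InPN {f} {x} {v} x-heard alone))
      where
      v≡1+w = trans v≡2+q (cong suc (sym w≡1+q))
    right-neighbour∈InW {x} x≡1+v x-heard | yes (u , u≢v , pu , x∈u) with 2 ≤? f u
    ... | yes 2≤fu = u , ball⊆InW 2≤fu x∈u
    ... | no  ¬2≤fu
      with ∣m-n∣≤1⇒n≡m⊎1+n≡m⊎n≡1+m (toℕ x) (toℕ u) (subst (d x u ≤_) (0<m∧m≱2⇒m≡1 pu ¬2≤fu) x∈u)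
    ...   | inj₁ u≡x          = u , subst (InW u) u≡x (centre∈InW pu)
    ...   | inj₂ (inj₁ 1+u≡x) = contradiction (toℕ-injective (suc-injective (trans 1+u≡x x≡1+v))) u≢v
    ...   | inj₂ (inj₂ u≡1+x) = via-unit x≡1+v (0<m∧m≱2⇒m≡1 pu ¬2≤fu) u≢v u≡1+x (pu , x∈u)

  module LeftOfRightGappedUnit {v q : Fin n} (fv≡1 : f v ≡ 1) (q≡2+v : toℕ q ≡ 2 + toℕ v)
                               (q-unc : Uncovered f q) where

    pv : InVplus f v
    pv = unit⇒InVplus fv≡1

    beyond-far-gap : ∀ {x u c₄ : Fin n} → f u ≡ 1 → u ≢ v → toℕ v ≡ 2 + toℕ u →
                     toℕ x ≡ suc (toℕ u) → toℕ u ≡ 2 + toℕ c₄ → Uncovered f c₄ → ∃ λ w → InW w (toℕ x)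
    beyond-far-gap {x} {u} {c₄} fu≡1 u≢v v≡2+u x≡1+u u≡2+c₄ c₄-unc with vertex-below u u≡2+c₄
    ... | c₃ , c₃≡1+c₄ with HearsOther? f c₃ u
    ...   | no alone = ⊥-elim (¬private-beyond-unit v q u c₃ fv≡1 (dist 2 q≡2+v) q-unc fu≡1 (dist′ 2 v≡2+u)
                                 (¬HearsOther⇒InPN {f} {c₃} {u} c₃-heard alone) (dist′ 1 u≡1+c₃)
                                 (dist′ 3 (trans v≡2+u (cong (2 +_) u≡1+c₃))))
      where
      u≡1+c₃ = trans u≡2+c₄ (cong suc (sym c₃≡1+c₄))
      c₃-heard : InH f c₃ u
      c₃-heard = unit⇒InVplus fu≡1 , ≤-reflexive (trans (dist′ 1 u≡1+c₃) (sym fu≡1))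
    ...   | yes (u′ , u′≢u , c₃-heard′) with 2 ≤? f u′
    ...     | yes 2≤fu′ = u′ , ball⊆InW 2≤fu′ (inside-left-edge 2≤fu′ (left-edge c₃-heard′ c₄-unc c₃≡1+c₄)
                                                               (trans x≡1+u (cong suc u≡2+c₄)))
    ...     | no  ¬2≤fu′ =
      contradiction (toℕ-injective (trans (sym unit-edge) (trans (+-comm (toℕ c₄) 2) (sym u≡2+c₄)))) u′≢u
      where
      unit-edge = trans (cong (λ t → toℕ c₄ + suc t) (sym (0<m∧m≱2⇒m≡1 (proj₁ c₃-heard′) ¬2≤fu′)))
                        (left-edge c₃-heard′ c₄-unc c₃≡1+c₄)

    via-unit : ∀ {x u : Fin n} → toℕ v ≡ suc (toℕ x) → f u ≡ 1 → u ≢ v → toℕ x ≡ suc (toℕ u) →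
               InH f x u → ∃ λ w → InW w (toℕ x)
    via-unit {x} {u} v≡1+x fu≡1 u≢v x≡1+u x-heard with RightGap? u
    ... | yes (q′ , uq′ , q′-unc) = ⊥-elim (q′-unc (v , subst (λ t → InH f t v) (sym q′≡v) (self-heard v pv)))
      where
      q′≡v : q′ ≡ v
      q′≡v = toℕ-injective (trans (unit-right-gap fu≡1 uq′) (sym (trans v≡1+x (cong suc x≡1+u))))
    ... | no ¬r with LeftGap? u
    ...   | no  ¬l = u , centred∈InW ¬l ¬r (proj₁ x-heard) (proj₂ x-heard)
    ...   | yes (c₄ , c₄u , c₄-unc) =
      beyond-far-gap fu≡1 u≢v (trans v≡1+x (cong suc x≡1+u)) x≡1+u (unit-left-gap fu≡1 c₄u) c₄-unc

    left-neighbour∈InW : ∀ {x : Fin n} → toℕ v ≡ suc (toℕ x) → InH f x v → ∃ λ w → InW w (toℕ x)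
    left-neighbour∈InW {x} v≡1+x x-heard with HearsOther? f x v
    ... | no alone with vertex-below q q≡2+v
    ...   | w , w≡1+v = ⊥-elim (¬private-opposite-gap v w q x fv≡1
                                  (dist 1 w≡1+v) (dist 1 q≡1+w) (dist 2 q≡2+v) q-unc
                                  (dist′ 1 v≡1+x) (dist′ 2 (trans w≡1+v (cong suc v≡1+x)))
                                  (¬HearsOther⇒InPN {f} {x} {v} x-heard alone))
      where
      q≡1+w = trans q≡2+v (cong suc (sym w≡1+v))
    left-neighbour∈InW {x} v≡1+x x-heard | yes (u , u≢v , pu , x∈u) with 2 ≤? f u
    ... | yes 2≤fu = u , ball⊆InW 2≤fu x∈u
    ... | no  ¬2≤fu
      with ∣m-n∣≤1⇒n≡m⊎1+n≡m⊎n≡1+m (toℕ x) (toℕ u) (subst (d x u ≤_) (0<m∧m≱2⇒m≡1 pu ¬2≤fu) x∈u)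
    ...   | inj₁ u≡x          = u , subst (InW u) u≡x (centre∈InW pu)
    ...   | inj₂ (inj₁ 1+u≡x) = via-unit v≡1+x (0<m∧m≱2⇒m≡1 pu ¬2≤fu) u≢v (sym 1+u≡x) (pu , x∈u)
    ...   | inj₂ (inj₂ u≡1+x) = contradiction (toℕ-injective (trans u≡1+x (sym v≡1+x))) u≢v

  covered∈InW : ∀ x v → InH f x v → ∃ λ w → InW w (toℕ x)
  covered∈InW x v (pv , x∈v) with 2 ≤? f v
  ... | yes 2≤fv = v , ball⊆InW 2≤fv x∈v
  ... | no  ¬2≤fv with 0<m∧m≱2⇒m≡1 pv ¬2≤fv
  ...   | fv≡1 with ∣m-n∣≤1⇒n≡m⊎1+n≡m⊎n≡1+m (toℕ x) (toℕ v) (subst (d x v ≤_) fv≡1 x∈v)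
                  | LeftGap? v | RightGap? v
  ...     | inj₁ v≡x          | _     | _     = v , subst (InW v) v≡x (centre∈InW pv)
  ...     | inj₂ (inj₁ 1+v≡x) | yes (q , qv , q-unc) | _ =
    RightOfLeftGappedUnit.right-neighbour∈InW fv≡1 (unit-left-gap fv≡1 qv) q-unc (sym 1+v≡x) (pv , x∈v)
  ...     | inj₂ (inj₁ 1+v≡x) | no _  | yes r = v , right-near∈InW pv r x∈v (subst (toℕ v ≤_) 1+v≡x (n≤1+n _))
  ...     | inj₂ (inj₂ v≡1+x) | yes l | _     = v , left-near∈InW pv l x∈v (subst (toℕ x ≤_) (sym v≡1+x) (n≤1+n _))
  ...     | inj₂ (inj₂ v≡1+x) | no _  | yes (q , vq , q-unc) =
    LeftOfRightGappedUnit.left-neighbour∈InW fv≡1 (unit-right-gap fv≡1 vq) q-unc v≡1+x (pv , x∈v)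
  ...     | inj₂ _            | no ¬l | no ¬r = v , centred∈InW ¬l ¬r pv x∈v

  vertex∈InW : ∀ x → ∃ λ w → InW w (toℕ x)
  vertex∈InW x with Covered? f x
  ... | yes (v , x-heard) = covered∈InW x v x-heard
  ... | no  x-unc         = uncovered∈InW x x-unc

  n≤3σ : n ≤ 3 * σ f
  n≤3σ = cover⇒≤3σ f start vertex∈InW

theorem3p12 : (n : ℕ) → 2 ≤ n →
    Broadcasts.LowerBroadcastIrrNumber (pathDist n) ((n + 2) / 3)
    × Broadcasts.BroadcastDomNumber (pathDist n) ((n + 2) / 3)
theorem3p12 n 2≤n =
  ((marks n , marks-maximal 2≤n , sumF-marks n) ,
   λ f maximal → n≤3*s⇒[n+2]/3≤s n (σ f) (MaximalIrredundantCover.n≤3σ 2≤n maximal)) ,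
  ((marks n , marks-dominating 2≤n , sumF-marks n) ,
   λ f dominating → n≤3*s⇒[n+2]/3≤s n (σ f) (dominating⇒n≤3σ dominating))
  where open Path n
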